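{- Let $P$ be a finite ranked poset with an $n$-dimensional lattice projection $\pi$ such that $\pi(P)\subseteq[a_1]\times\cdots\times[a_n]$. Let $v=(v_1,\dots,v_n)\in\{\pm1\}^n$, $\gamma\in\{1,\dots,n\}$, and $v^*=(v_1,\dots,v_{\gamma-1},v_{\gamma+1},\dots,v_n)$. For $1\le j\le a_\gamma$ let $T^j:J(P)\to J(P)$ apply the toggles $t_x$ for all $x\in P$ with $\pi(x)_\gamma=j$, in decreasing order of $\langle\pi(x)^*,v^*\rangle$, where $\pi(x)^*$ is $\pi(x)$ with its $\gamma$-th coordinate deleted. Then: if $v_\gamma=1$, $\mathrm{Pro}_{\pi,v}=T^1\circ T^2\circ\cdots\circ T^{a_\gamma}$ (layer $a_\gamma$ processed first); if $v_\gamma=-1$, $\mathrm{Pro}_{\pi,v}=T^{a_\gamma}\circ\cdots\circ T^1$ (layer $1$ processed first).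
   Context: $[m]=\{1,\dots,m\}$. An $n$-dimensional lattice projection of a ranked poset $P$ is an order- and rank-preserving map $\pi:P\to\mathbb{Z}^n$, where $\mathbb{Z}^n$ has rank function the sum of coordinates and $x\le y$ iff $y-x\in(\mathbb{Z}_{\ge0})^n$. $J(P)$ is the set of order ideals of $P$; the toggle $t_e(I)$ is $I\cup\{e\}$ if $e\notin I$ and this is an order ideal, $I\setminus\{e\}$ if $e\in I$ and this is an order ideal, and $I$ otherwise. For $v\in\{\pm1\}^n$, $T^i_{\pi,v}$ is the product of the toggles $t_x$ over $x\in P$ with $\langle\pi(x),v\rangle=i$ (these commute), and $\mathrm{Pro}_{\pi,v}=\cdots T^{ -1}_{\pi,v}T^0_{\pi,v}T^1_{\pi,v}\cdots$ applies the $T^i_{\pi,v}$ in decreasing order of $i$. The map $T^j$ is the toggle product of $\mathrm{Pro}_{\pi,v^*}$ on the preimage of the layer $\{y\in\pi(P):y_\gamma=j\}$. -}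

module Defs where

open import Data.Nat as ℕ using (ℕ; zero; suc)
open import Data.Integer as ℤ using (ℤ; +_; _+_; _-_; _*_; -_; 1ℤ)
open import Data.Fin using (Fin)
open import Data.Fin.Properties using (all?)
open import Data.Bool using (Bool; true; false; if_then_else_)
open import Data.Vec using (Vec; lookup; _[_]≔_)
open import Data.Vec.Functional using (Vector; removeAt)
open import Data.List using (List; []; _∷_; filter; allFin)
open import Data.Product using (_×_; ∃)
open import Relation.Nullary using (¬_; Dec; does; _→-dec_)
open import Relation.Binary using (Rel; Decidable; IsPartialOrder)
open import Relation.Binary.PropositionalEquality using (_≡_; _≢_)
open import Level using (0ℓ)

record FinPoset : Set₁ where
  field
    size    : ℕ
    _≤_     : Rel (Fin size) 0ℓ
    ≤-dec   : Decidable _≤_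
    isPO    : IsPartialOrder _≡_ _≤_

module _ (P : FinPoset) where
  open FinPoset P

  Elt : Set
  Elt = Fin size

  _<ₚ_ : Elt → Elt → Set
  x <ₚ y = (x ≤ y) × (x ≢ y)

  _⋖_ : Elt → Elt → Set
  x ⋖ y = (x <ₚ y) × (¬ ∃ λ z → (x <ₚ z) × (z <ₚ y))

  IsRankFunction : (Elt → ℤ) → Set
  IsRankFunction rk = ∀ x y → x ⋖ y → rk y ≡ rk x + 1ℤ

  SubsetP : Set
  SubsetP = Vec Bool size

  _∈ₛ_ : Elt → SubsetP → Set
  x ∈ₛ I = lookup I x ≡ true

  IsOrderIdeal : SubsetP → Set
  IsOrderIdeal I = ∀ x y → y ≤ x → x ∈ₛ I → y ∈ₛ I

  isOrderIdeal? : (I : SubsetP) → Dec (IsOrderIdeal I)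
  isOrderIdeal? I =
    all? λ x → all? λ y → ≤-dec y x →-dec (Data.Bool._≟_ (lookup I x) true →-dec Data.Bool._≟_ (lookup I y) true)
    where import Data.Bool

  toggle : Elt → SubsetP → SubsetP
  toggle e I with lookup I e
  ... | false = if does (isOrderIdeal? (I [ e ]≔ true)) then I [ e ]≔ true else I
  ... | true  = if does (isOrderIdeal? (I [ e ]≔ false)) then I [ e ]≔ false else I

  toggleList : List Elt → SubsetP → SubsetP
  toggleList []       I = I
  toggleList (x ∷ xs) I = toggleList xs (toggle x I)

  -- toggle product over the elements x of cands with key x = i
  -- (these toggles commute in the situation of the theorem)
  levelToggle : List Elt → (Elt → ℤ) → ℤ → SubsetP → SubsetP
  levelToggle cands key i = toggleList (filter (λ x → key x ℤ.≟ i) cands)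

  sweepDown : List Elt → (Elt → ℤ) → ℤ → ℕ → SubsetP → SubsetP
  sweepDown cands key hi zero    I = I
  sweepDown cands key hi (suc k) I =
    sweepDown cands key (hi - 1ℤ) k (levelToggle cands key hi I)

sumℤ : ∀ {n} → Vector ℤ n → ℤ
sumℤ = Data.Vec.Functional.foldr _+_ (+ 0)
  where import Data.Vec.Functional

⟪_,_⟫ : ∀ {n} → Vector ℤ n → Vector ℤ n → ℤ
⟪ x , v ⟫ = sumℤ (λ i → x i * v i)

sumℕ : ∀ {n} → Vector ℕ n → ℕ
sumℕ = Data.Vec.Functional.foldr ℕ._+_ 0
  where import Data.Vec.Functional

module _ (P : FinPoset) where
  open FinPoset P

  IsLatticeProjection : ∀ {n} → (Elt P → ℤ) → (Elt P → Vector ℤ n) → Set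
  IsLatticeProjection rk π =
    (∀ x y → x ≤ y → ∀ i → π x i ℤ.≤ π y i)
    × (∀ x → sumℤ (π x) ≡ rk x)

  -- Pro_{π,v}: the products T^i_{π,v} applied in decreasing order of i.
  -- All values ⟨π(x),v⟩ lie in [-B,B] with B = a₁+⋯+aₙ, so it suffices to
  -- run i from B down to -B (all other T^i are the identity).
  Pro : ∀ {n} → (a : Vector ℕ n) → (Elt P → Vector ℤ n) → Vector ℤ n
      → SubsetP P → SubsetP P
  Pro a π v = sweepDown P (allFin size) (λ x → ⟪ π x , v ⟫)
                (+ sumℕ a) (suc (sumℕ a ℕ.+ sumℕ a))

  layerT : ∀ {n} → (a : Vector ℕ (suc n)) → (Elt P → Vector ℤ (suc n))
         → Vector ℤ (suc n) → Fin (suc n) → ℕ → SubsetP P → SubsetP P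
  layerT a π v γ j =
    sweepDown P (filter (λ x → π x γ ℤ.≟ + j) (allFin size))
      (λ x → ⟪ removeAt (π x) γ , removeAt v γ ⟫)
      (+ sumℕ a) (suc (sumℕ a ℕ.+ sumℕ a))

  layersDown : ∀ {n} → (a : Vector ℕ (suc n)) → (Elt P → Vector ℤ (suc n))
             → Vector ℤ (suc n) → Fin (suc n) → ℕ → SubsetP P → SubsetP P
  layersDown a π v γ zero    I = I
  layersDown a π v γ (suc k) I = layersDown a π v γ k (layerT a π v γ (suc k) I)

  layersUp : ∀ {n} → (a : Vector ℕ (suc n)) → (Elt P → Vector ℤ (suc n))
           → Vector ℤ (suc n) → Fin (suc n) → ℕ → SubsetP P → SubsetP P
  layersUp a π v γ zero    I = I
  layersUp a π v γ (suc k) I = layerT a π v γ (suc k) (layersUp a π v γ k I)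

-- Along a cover x ⋖ y exactly one coordinate of π goes up by one, so ⟨π(·), v⟩ changes by ±1.
-- Toggles of elements that do not cover one another commute, so a product of all toggles is
-- determined by the order in which it visits the two ends of each cover. Pro visits them in
-- decreasing ⟨π(·), v⟩. Inside a layer (π(·)_γ constant) the layered product uses ⟨π(·)*, v*⟩,
-- which differs from ⟨π(·), v⟩ by the constant v_γ π(·)_γ; a cover between two layers moves in
-- direction γ only, so ⟨π(·), v⟩ changes there exactly as v_γ π(·)_γ does, and the layers are
-- processed in decreasing v_γ π(·)_γ.

module Submission where

open import Defs
open import Algebra.Bundles using (CommutativeMonoid; AbelianGroup)
open import Data.Bool using (Bool; true; false; not; if_then_else_)
import Data.Bool as Bool
open import Data.Empty using (⊥; ⊥-elim)
open import Data.Fin using (Fin; _≟_; punchIn) renaming (zero to fzero; suc to fsuc)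
open import Data.Fin.Properties using (punchInᵢ≢i)
open import Data.Integer as ℤ using (ℤ; _≤_; +_; -[1+_]; _+_; _-_; _*_; -_; 1ℤ; ∣_∣; +≤+; -≤+; -<+; -<-)
import Data.Integer.Properties as ℤ
open import Data.Integer.Tactic.RingSolver using (solve-∀)
open import Data.List using (List; []; _∷_; _++_; filter; allFin)
open import Data.List.Membership.Propositional using (_∈_)
open import Data.List.Membership.Propositional.Properties using (∈-++⁺ˡ; ∈-++⁺ʳ; ∈-++⁻; ∈-∃++; ∈-filter⁺; ∈-filter⁻; ∈-allFin)
open import Data.List.Membership.Propositional.Properties.WithK using (unique∧set⇒bag)
open import Data.List.Relation.Binary.BagAndSetEquality using (∼bag⇒↭)
open import Data.List.Relation.Binary.Permutation.Propositional using (_↭_; ↭-sym)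
open import Data.List.Relation.Binary.Permutation.Propositional.Properties using (↭-empty-inv; ∈-resp-↭; drop-mid)
open import Data.List.Relation.Unary.All as All using (All; []; _∷_)
import Data.List.Relation.Unary.All.Properties as All
open import Data.List.Relation.Unary.AllPairs using (AllPairs; []; _∷_)
import Data.List.Relation.Unary.AllPairs.Properties as AllPairs
open import Data.List.Relation.Unary.Any using (here; there)
open import Data.List.Relation.Unary.Unique.Propositional using (Unique)
import Data.List.Relation.Unary.Unique.Propositional.Properties as Unique
open import Data.Nat as ℕ using (ℕ; zero; suc)
import Data.Nat.Properties as ℕ
open import Data.Product using (_×_; _,_; ∃; proj₁; proj₂)
open import Data.Sum using (_⊎_; inj₁; inj₂)
open import Data.Vec using (lookup; _[_]≔_)
open import Data.Vec.Properties using (lookup∘update; lookup∘update′; []≔-commutes; []≔-lookup)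
open import Data.Vec.Functional using (Vector; foldr; removeAt; tail)
open import Function using (_∘_)
open import Function.Bundles using (mk⇔)
open import Level using (0ℓ)
open import Relation.Unary using (Decidable)
open import Relation.Binary using (Rel)
open import Relation.Binary.PropositionalEquality using (_≡_; _≢_; refl; sym; trans; cong; cong₂; subst; subst₂; module ≡-Reasoning)
open import Relation.Nullary using (¬_; Dec; yes; no; does)
open import Relation.Nullary.Decidable using (decidable-stable; does-⇔)

module _ {c ℓ} (M : CommutativeMonoid c ℓ) where
  open CommutativeMonoid M using (Carrier; _∙_; ε; _≈_; ∙-congˡ; commutativeSemigroup; setoid) renaming (refl to ≈-refl)
  open import Algebra.Properties.CommutativeSemigroup commutativeSemigroup using (x∙yz≈y∙xz)
  open import Relation.Binary.Reasoning.Setoid setoid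

  foldr-removeAt : ∀ {n} (h : Vector Carrier (suc n)) k →
                   foldr _∙_ ε h ≈ h k ∙ foldr _∙_ ε (removeAt h k)
  foldr-removeAt h fzero = ≈-refl
  foldr-removeAt {suc n} h (fsuc k) = begin
    h fzero ∙ foldr _∙_ ε (tail h)
      ≈⟨ ∙-congˡ (foldr-removeAt (tail h) k) ⟩
    h fzero ∙ (h (fsuc k) ∙ foldr _∙_ ε (removeAt (tail h) k))
      ≈⟨ x∙yz≈y∙xz _ _ _ ⟩
    h (fsuc k) ∙ foldr _∙_ ε (removeAt h (fsuc k)) ∎

open import Algebra.Properties.Group (AbelianGroup.group ℤ.+-0-abelianGroup) using (∙-cancelˡ)

sumℤ-removeAt : ∀ {n} (h : Vector ℤ (suc n)) k → sumℤ h ≡ h k + sumℤ (removeAt h k)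
sumℤ-removeAt = foldr-removeAt ℤ.+-0-commutativeMonoid

sumℕ-removeAt : ∀ {n} (h : Vector ℕ (suc n)) k → sumℕ h ≡ h k ℕ.+ sumℕ (removeAt h k)
sumℕ-removeAt = foldr-removeAt ℕ.+-0-commutativeMonoid

sumℤ-cong : ∀ {n} {f g : Vector ℤ n} → (∀ i → f i ≡ g i) → sumℤ f ≡ sumℤ g
sumℤ-cong {zero} f≗g = refl
sumℤ-cong {suc n} f≗g = cong₂ _+_ (f≗g fzero) (sumℤ-cong (f≗g ∘ fsuc))

sumℤ-+-pos : ∀ {n} (f : Vector ℤ n) (d : Vector ℕ n) →
             sumℤ (λ i → f i + + d i) ≡ sumℤ f + + sumℕ d
sumℤ-+-pos {zero} f d = refl
sumℤ-+-pos {suc n} f d =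
  trans (cong (_+_ (f fzero + + d fzero)) (sumℤ-+-pos (tail f) (tail d)))
        (interchange (f fzero) (+ d fzero) (sumℤ (tail f)) (+ sumℕ (tail d)))
  where
  interchange : ∀ a b c e → (a + b) + (c + e) ≡ (a + c) + (b + e)
  interchange = solve-∀

sumℕ≡0⇒≡0 : ∀ {n} (d : Vector ℕ n) → sumℕ d ≡ 0 → ∀ i → d i ≡ 0
sumℕ≡0⇒≡0 d Σ≡0 fzero = ℕ.m+n≡0⇒m≡0 (d fzero) Σ≡0
sumℕ≡0⇒≡0 d Σ≡0 (fsuc i) = sumℕ≡0⇒≡0 (tail d) (ℕ.m+n≡0⇒n≡0 (d fzero) Σ≡0) i

sumℕ≡1⇒unit : ∀ {n} (d : Vector ℕ n) → sumℕ d ≡ 1 →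
              ∃ λ k → d k ≡ 1 × (∀ i → i ≢ k → d i ≡ 0)
sumℕ≡1⇒unit {suc n} d Σ≡1 with d fzero in d₀
... | zero with sumℕ≡1⇒unit (tail d) Σ≡1
...   | k , dk≡1 , rest = fsuc k , dk≡1 , λ { fzero _ → d₀ ; (fsuc i) i≢k → rest i (i≢k ∘ cong fsuc) }
sumℕ≡1⇒unit {suc n} d Σ≡1 | suc zero =
  fzero , d₀ , λ { fzero 0≢0 → ⊥-elim (0≢0 refl) ; (fsuc i) _ → sumℕ≡0⇒≡0 (tail d) (ℕ.suc-injective Σ≡1) i }

≤-decompose : ∀ {n} (f g : Vector ℤ n) → (∀ i → f i ℤ.≤ g i) →
              ∃ λ (d : Vector ℕ n) → ∀ i → g i ≡ f i + + d i
≤-decompose f g f≤g =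
  (λ i → ∣ f i - g i ∣) , λ i → trans (split (g i) (f i)) (cong (_+_ (f i)) (sym (ℤ.∣-∣-≤ (f≤g i))))
  where
  split : ∀ x y → x ≡ y + (x - y)
  split = solve-∀

unit-increment : ∀ {n} (f g : Vector ℤ n) → (∀ i → f i ℤ.≤ g i) → sumℤ g ≡ sumℤ f + 1ℤ →
                 ∃ λ k → g k ≡ f k + 1ℤ × (∀ i → i ≢ k → g i ≡ f i)
unit-increment f g f≤g Σg≡Σf+1
  with d , g≡f+d ← ≤-decompose f g f≤g
  with k , dk≡1 , rest ← sumℕ≡1⇒unit d (cong ∣_∣ (∙-cancelˡ (sumℤ f) _ _
         (trans (sym (sumℤ-+-pos f d)) (trans (sym (sumℤ-cong g≡f+d)) Σg≡Σf+1))))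
  = k , trans (g≡f+d k) (cong (λ m → f k + + m) dk≡1)
      , λ i i≢k → trans (g≡f+d i) (trans (cong (λ m → f i + + m) (rest i i≢k)) (ℤ.+-identityʳ (f i)))

⟪⟫-removeAt : ∀ {n} (f w : Vector ℤ (suc n)) k →
              ⟪ f , w ⟫ ≡ f k * w k + ⟪ removeAt f k , removeAt w k ⟫
⟪⟫-removeAt f w = sumℤ-removeAt (λ i → f i * w i)

⟪removeAt⟫-cong : ∀ {n} {f g : Vector ℤ (suc n)} (w : Vector ℤ (suc n)) k →
                  (∀ i → i ≢ k → f i ≡ g i) →
                  ⟪ removeAt f k , removeAt w k ⟫ ≡ ⟪ removeAt g k , removeAt w k ⟫
⟪removeAt⟫-cong w k f≗g =
  sumℤ-cong λ i → cong (_* w (punchIn k i)) (f≗g (punchIn k i) (punchInᵢ≢i k i))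

⟪⟫-increment : ∀ {n} (f g w : Vector ℤ (suc n)) k →
               g k ≡ f k + 1ℤ → (∀ i → i ≢ k → g i ≡ f i) → ⟪ g , w ⟫ ≡ ⟪ f , w ⟫ + w k
⟪⟫-increment f g w k gk≡fk+1 g≗f = begin
  ⟪ g , w ⟫                        ≡⟨ ⟪⟫-removeAt g w k ⟩
  g k * w k + rest g               ≡⟨ cong₂ (λ x s → x * w k + s) gk≡fk+1 (⟪removeAt⟫-cong w k g≗f) ⟩
  (f k + 1ℤ) * w k + rest f        ≡⟨ distrib (f k) (w k) (rest f) ⟩
  (f k * w k + rest f) + w k       ≡⟨ cong (_+ w k) (⟪⟫-removeAt f w k) ⟨
  ⟪ f , w ⟫ + w k                  ∎
  where
  open ≡-Reasoning
  rest : Vector ℤ _ → ℤ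
  rest h = ⟪ removeAt h k , removeAt w k ⟫
  distrib : ∀ x y s → (x + 1ℤ) * y + s ≡ (x * y + s) + y
  distrib = solve-∀

∣⟪⟫∣≤ : ∀ {n} (f w : Vector ℤ n) (a : Vector ℕ n) →
        (∀ i → ∣ f i ∣ ℕ.≤ a i) → (∀ i → ∣ w i ∣ ≡ 1) → ∣ ⟪ f , w ⟫ ∣ ℕ.≤ sumℕ a
∣⟪⟫∣≤ {zero} f w a _ _ = ℕ.z≤n
∣⟪⟫∣≤ {suc n} f w a ∣f∣≤a ∣w∣≡1 = begin
  ∣ f fzero * w fzero + ⟪ tail f , tail w ⟫ ∣          ≤⟨ ℤ.∣i+j∣≤∣i∣+∣j∣ (f fzero * w fzero) ⟪ tail f , tail w ⟫ ⟩
  ∣ f fzero * w fzero ∣ ℕ.+ ∣ ⟪ tail f , tail w ⟫ ∣    ≡⟨ cong (ℕ._+ ∣ ⟪ tail f , tail w ⟫ ∣) (ℤ.abs-* (f fzero) (w fzero)) ⟩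
  ∣ f fzero ∣ ℕ.* ∣ w fzero ∣ ℕ.+ ∣ ⟪ tail f , tail w ⟫ ∣
    ≡⟨ cong (λ m → ∣ f fzero ∣ ℕ.* m ℕ.+ ∣ ⟪ tail f , tail w ⟫ ∣) (∣w∣≡1 fzero) ⟩
  ∣ f fzero ∣ ℕ.* 1 ℕ.+ ∣ ⟪ tail f , tail w ⟫ ∣
    ≤⟨ ℕ.+-mono-≤ (ℕ.≤-trans (ℕ.≤-reflexive (ℕ.*-identityʳ _)) (∣f∣≤a fzero))
                 (∣⟪⟫∣≤ (tail f) (tail w) (tail a) (∣f∣≤a ∘ fsuc) (∣w∣≡1 ∘ fsuc)) ⟩
  a fzero ℕ.+ sumℕ (tail a) ∎
  where open ℕ.≤-Reasoning

changed-coordinate-unique : ∀ {n} {f g : Vector ℤ n} k γ → (∀ i → i ≢ k → g i ≡ f i) → f γ ≢ g γ →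
                            ∀ i → i ≢ γ → g i ≡ f i
changed-coordinate-unique k γ g≗f fγ≢gγ i i≢γ with k ≟ γ
... | yes refl = g≗f i i≢γ
... | no k≢γ = ⊥-elim (fγ≢gγ (sym (g≗f γ (k≢γ ∘ sym))))

+-unit-≢ : ∀ i {w} → ∣ w ∣ ≡ 1 → i + w ≢ i
+-unit-≢ i ∣w∣≡1 i+w≡i
  with () ← trans (sym ∣w∣≡1) (cong ∣_∣ (∙-cancelˡ i _ (+ 0) (trans i+w≡i (sym (ℤ.+-identityʳ i)))))

sweep-window : ∀ B q → ∣ q ∣ ℕ.≤ B → (+ B - + suc (B ℕ.+ B) ℤ.< q) × (q ℤ.≤ + B)
sweep-window B q ∣q∣≤B = subst (ℤ._< q) (sym (shift (+ B))) (below q ∣q∣≤B) , above q ∣q∣≤B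
  where
  shift : ∀ b → b - (1ℤ + (b + b)) ≡ - (1ℤ + b)
  shift = solve-∀
  below : ∀ q → ∣ q ∣ ℕ.≤ B → -[1+ B ] ℤ.< q
  below (+ m) _ = -<+
  below -[1+ m ] m<B = -<- m<B
  above : ∀ q → ∣ q ∣ ℕ.≤ B → q ℤ.≤ + B
  above (+ m) m≤B = +≤+ m≤B
  above -[1+ m ] _ = -≤+

module _ {A : Set} where

  ↭-of-enumerations : {xs ys : List A} → Unique xs → Unique ys →
                      (∀ z → z ∈ xs) → (∀ z → z ∈ ys) → xs ↭ ys
  ↭-of-enumerations xs! ys! ∈xs ∈ys =
    ∼bag⇒↭ (unique∧set⇒bag xs! ys! (mk⇔ (λ _ → ∈ys _) (λ _ → ∈xs _)))

  module _ {R : Rel A 0ℓ} where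

    allPairs-tabulate : ∀ {xs} → (∀ {x y} → x ∈ xs → y ∈ xs → R x y) → AllPairs R xs
    allPairs-tabulate {[]} _ = []
    allPairs-tabulate {x ∷ xs} R-on =
      All.tabulate (R-on (here refl) ∘ there) ∷ allPairs-tabulate (λ p q → R-on (there p) (there q))

    allPairs-++⁺ : ∀ {xs ys} → AllPairs R xs → AllPairs R ys →
                   (∀ {x y} → x ∈ xs → y ∈ ys → R x y) → AllPairs R (xs ++ ys)
    allPairs-++⁺ Rxs Rys R-across =
      AllPairs.++⁺ Rxs Rys (All.tabulate λ x∈ → All.tabulate λ y∈ → R-across x∈ y∈)

    allPairs-removeMid : ∀ ys {x zs} → AllPairs R (ys ++ x ∷ zs) →
                         All (λ y → R y x) ys × AllPairs R (ys ++ zs)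
    allPairs-removeMid [] (_ ∷ Rzs) = [] , Rzs
    allPairs-removeMid (y ∷ ys) (Ry ∷ Rrest) with allPairs-removeMid ys Rrest
    ... | ys-R-x , Rys++zs with before , Rx∷zs ← All.++⁻ ys Ry =
      (All.lookup Rx∷zs (here refl) ∷ ys-R-x) , (All.++⁺ before (All.tail Rx∷zs) ∷ Rys++zs)

module Toggling (P : FinPoset) where

  infix 4 _<ᴾ_ _⋖ᴾ_ _∈ᴾ_

  _<ᴾ_ : Rel (Elt P) 0ℓ
  _<ᴾ_ = _<ₚ_ P

  _⋖ᴾ_ : Rel (Elt P) 0ℓ
  _⋖ᴾ_ = _⋖_ P

  _∈ᴾ_ : Elt P → SubsetP P → Set
  _∈ᴾ_ = _∈ₛ_ P

  Adjacent : Rel (Elt P) 0ℓ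
  Adjacent x y = x ⋖ᴾ y ⊎ y ⋖ᴾ x

  Adjacent-sym : ∀ {x y} → Adjacent x y → Adjacent y x
  Adjacent-sym (inj₁ x⋖y) = inj₂ x⋖y
  Adjacent-sym (inj₂ y⋖x) = inj₁ y⋖x

  module _ {I : SubsetP P} {x : Elt P} where

    insert-ideal⇒below∈ : IsOrderIdeal P (I [ x ]≔ true) → ∀ {w} → w <ᴾ x → w ∈ᴾ I
    insert-ideal⇒below∈ I+x (w≤x , w≢x) =
      trans (sym (lookup∘update′ w≢x I true)) (I+x x _ w≤x (lookup∘update x I true))

    below∈⇒insert-ideal : IsOrderIdeal P I → (∀ {w} → w <ᴾ x → w ∈ᴾ I) → IsOrderIdeal P (I [ x ]≔ true)
    below∈⇒insert-ideal I-ideal below∈ u w w≤u u∈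
      with w ≟ x | u ≟ x
    ... | yes refl | _ = lookup∘update x I true
    ... | no w≢x | yes refl = trans (lookup∘update′ w≢x I true) (below∈ (w≤u , w≢x))
    ... | no w≢x | no u≢x =
      trans (lookup∘update′ w≢x I true) (I-ideal u w w≤u (trans (sym (lookup∘update′ u≢x I true)) u∈))

    remove-ideal⇒above∉ : IsOrderIdeal P (I [ x ]≔ false) → ∀ {w} → x <ᴾ w → ¬ w ∈ᴾ I
    remove-ideal⇒above∉ I-x (x≤w , x≢w) w∈
      with () ← trans (sym (lookup∘update x I false))
                      (I-x _ x x≤w (trans (lookup∘update′ (x≢w ∘ sym) I false) w∈))

    above∉⇒remove-ideal : IsOrderIdeal P I → (∀ {w} → x <ᴾ w → ¬ w ∈ᴾ I) → IsOrderIdeal P (I [ x ]≔ false)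
    above∉⇒remove-ideal I-ideal above∉ u w w≤u u∈
      with u ≟ x
    ... | yes refl with () ← trans (sym (lookup∘update u I false)) u∈
    ... | no u≢x with w ≟ x
    ...   | yes refl = ⊥-elim (above∉ (w≤u , u≢x ∘ sym) u∈I)
      where u∈I = trans (sym (lookup∘update′ u≢x I false)) u∈
    ...   | no w≢x =
      trans (lookup∘update′ w≢x I false) (I-ideal u w w≤u (trans (sym (lookup∘update′ u≢x I false)) u∈))

  -- Whether x can be inserted into / removed from an ideal depends only on the elements below /
  -- above x; changing the ideal at a y not adjacent to x changes neither (an intermediate element
  -- between y and x carries the information across).
  module _ (I J : SubsetP P) {y : Elt P} (I-ideal : IsOrderIdeal P I) (J-ideal : IsOrderIdeal P J)
           (J≗I : ∀ z → z ≢ y → lookup J z ≡ lookup I z) {x : Elt P} (¬adj : ¬ Adjacent x y) where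

    insert-ideal-transfer : IsOrderIdeal P (I [ x ]≔ true) → IsOrderIdeal P (J [ x ]≔ true)
    insert-ideal-transfer I+x = below∈⇒insert-ideal {J} J-ideal below∈J
      where
      below∈J : ∀ {w} → w <ᴾ x → w ∈ᴾ J
      below∈J {w} w<x with w ≟ y
      ... | no w≢y = trans (J≗I w w≢y) (insert-ideal⇒below∈ {I} I+x w<x)
      ... | yes refl = decidable-stable (lookup J w Bool.≟ true) λ w∉J →
              ¬adj (inj₂ (w<x , λ (z , (w≤z , w≢z) , z<x) →
                w∉J (J-ideal z w w≤z (trans (J≗I z (w≢z ∘ sym)) (insert-ideal⇒below∈ {I} I+x z<x)))))

    remove-ideal-transfer : IsOrderIdeal P (I [ x ]≔ false) → IsOrderIdeal P (J [ x ]≔ false)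
    remove-ideal-transfer I-x = above∉⇒remove-ideal {J} J-ideal above∉J
      where
      above∉J : ∀ {w} → x <ᴾ w → ¬ w ∈ᴾ J
      above∉J {w} x<w w∈J with w ≟ y
      ... | no w≢y = remove-ideal⇒above∉ {I} I-x x<w (trans (sym (J≗I w w≢y)) w∈J)
      ... | yes refl = ¬adj (inj₁ (x<w , λ (z , x<z , (z≤w , z≢w)) →
              remove-ideal⇒above∉ {I} I-x x<z (trans (sym (J≗I z z≢w)) (J-ideal w z z≤w w∈J))))

  toggledValue : Elt P → SubsetP P → Bool
  toggledValue e I =
    if lookup I e then not (does (isOrderIdeal? P (I [ e ]≔ false)))
    else does (isOrderIdeal? P (I [ e ]≔ true))

  toggle-as-update : ∀ e I → toggle P e I ≡ I [ e ]≔ toggledValue e I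
  toggle-as-update e I with lookup I e in I[e]
  ... | false with does (isOrderIdeal? P (I [ e ]≔ true))
  ...   | true  = refl
  ...   | false = sym (trans (cong (I [ e ]≔_) (sym I[e])) ([]≔-lookup I e))
  toggle-as-update e I | true with does (isOrderIdeal? P (I [ e ]≔ false))
  ...   | true  = refl
  ...   | false = sym (trans (cong (I [ e ]≔_) (sym I[e])) ([]≔-lookup I e))

  toggle-≢ : ∀ e I {z} → z ≢ e → lookup (toggle P e I) z ≡ lookup I z
  toggle-≢ e I z≢e = trans (cong (λ J → lookup J _) (toggle-as-update e I)) (lookup∘update′ z≢e I _)

  private
    keep-if-ideal : ∀ {I J} (J? : Dec (IsOrderIdeal P J)) → IsOrderIdeal P I →
                    IsOrderIdeal P (if does J? then J else I)
    keep-if-ideal (yes J-ideal) _ = J-ideal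
    keep-if-ideal (no _) I-ideal = I-ideal

  toggle-preserves-ideal : ∀ e I → IsOrderIdeal P I → IsOrderIdeal P (toggle P e I)
  toggle-preserves-ideal e I with lookup I e
  ... | false = keep-if-ideal {I} {I [ e ]≔ true} (isOrderIdeal? P (I [ e ]≔ true))
  ... | true  = keep-if-ideal {I} {I [ e ]≔ false} (isOrderIdeal? P (I [ e ]≔ false))

  toggledValue-transfer : ∀ I J {y x} → IsOrderIdeal P I → IsOrderIdeal P J →
                          (∀ z → z ≢ y → lookup J z ≡ lookup I z) → x ≢ y → ¬ Adjacent x y →
                          toggledValue x J ≡ toggledValue x I
  toggledValue-transfer I J {y} {x} I-ideal J-ideal J≗I x≢y ¬adj rewrite J≗I x x≢y with lookup I x
  ... | true  = cong not (does-⇔ (mk⇔ (remove-ideal-transfer J I J-ideal I-ideal I≗J ¬adj)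
                                      (remove-ideal-transfer I J I-ideal J-ideal J≗I ¬adj))
                                 (isOrderIdeal? P (J [ x ]≔ false)) (isOrderIdeal? P (I [ x ]≔ false)))
    where I≗J = λ z z≢y → sym (J≗I z z≢y)
  ... | false = does-⇔ (mk⇔ (insert-ideal-transfer J I J-ideal I-ideal I≗J ¬adj)
                           (insert-ideal-transfer I J I-ideal J-ideal J≗I ¬adj))
                       (isOrderIdeal? P (J [ x ]≔ true)) (isOrderIdeal? P (I [ x ]≔ true))
    where I≗J = λ z z≢y → sym (J≗I z z≢y)

  toggle-comm : ∀ x y I → IsOrderIdeal P I → ¬ Adjacent x y →
                toggle P x (toggle P y I) ≡ toggle P y (toggle P x I)
  toggle-comm x y I I-ideal ¬adj with x ≟ y
  ... | yes refl = refl
  ... | no x≢y = begin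
    toggle P x (toggle P y I)                             ≡⟨ toggle-as-update x (toggle P y I) ⟩
    toggle P y I [ x ]≔ toggledValue x (toggle P y I)
      ≡⟨ cong₂ (λ J b → J [ x ]≔ b) (toggle-as-update y I) (transfer y x≢y ¬adj) ⟩
    (I [ y ]≔ toggledValue y I) [ x ]≔ toggledValue x I   ≡⟨ []≔-commutes I y x (x≢y ∘ sym) ⟩
    (I [ x ]≔ toggledValue x I) [ y ]≔ toggledValue y I
      ≡⟨ cong₂ (λ J b → J [ y ]≔ b) (toggle-as-update x I) (transfer x (x≢y ∘ sym) (¬adj ∘ Adjacent-sym)) ⟨
    toggle P x I [ y ]≔ toggledValue y (toggle P x I)     ≡⟨ toggle-as-update y (toggle P x I) ⟨
    toggle P y (toggle P x I)                             ∎
    where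
    open ≡-Reasoning
    transfer : ∀ e {e′} → e′ ≢ e → ¬ Adjacent e′ e → toggledValue e′ (toggle P e I) ≡ toggledValue e′ I
    transfer e = toggledValue-transfer I (toggle P e I) I-ideal (toggle-preserves-ideal e I I-ideal)
                                       (λ _ → toggle-≢ e I)

  toggleList-++ : ∀ xs ys I → toggleList P (xs ++ ys) I ≡ toggleList P ys (toggleList P xs I)
  toggleList-++ [] ys I = refl
  toggleList-++ (x ∷ xs) ys I = toggleList-++ xs ys (toggle P x I)

  toggle-toggleList-comm : ∀ x I ys → IsOrderIdeal P I → All (¬_ ∘ Adjacent x) ys →
                           toggle P x (toggleList P ys I) ≡ toggleList P ys (toggle P x I)
  toggle-toggleList-comm x I [] _ _ = refl
  toggle-toggleList-comm x I (y ∷ ys) I-ideal (¬adj ∷ ¬adjs) =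
    trans (toggle-toggleList-comm x (toggle P y I) ys (toggle-preserves-ideal y I I-ideal) ¬adjs)
          (cong (toggleList P ys) (toggle-comm x y I I-ideal ¬adj))

  Descends : (Elt P → ℤ) → Rel (Elt P) 0ℓ
  Descends ord x y = Adjacent x y → ord y ℤ.< ord x

  -- The head of one list commutes past everything preceding it in the other.
  toggleList-↭ : ∀ ord {xs ys} → xs ↭ ys → AllPairs (Descends ord) xs → AllPairs (Descends ord) ys →
                 ∀ I → IsOrderIdeal P I → toggleList P xs I ≡ toggleList P ys I
  toggleList-↭ ord {[]} xs↭ys _ _ _ _ rewrite ↭-empty-inv (↭-sym xs↭ys) = refl
  toggleList-↭ ord {x ∷ xs} xs↭ys (x↓ ∷ xs↓) ys↓ I I-ideal
    with us , ws , refl ← ∈-∃++ (∈-resp-↭ xs↭ys (here refl))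
    with us↓x , us++ws↓ ← allPairs-removeMid us ys↓ = begin
    toggleList P xs (toggle P x I)
      ≡⟨ toggleList-↭ ord xs↭us++ws xs↓ us++ws↓ (toggle P x I) (toggle-preserves-ideal x I I-ideal) ⟩
    toggleList P (us ++ ws) (toggle P x I)              ≡⟨ toggleList-++ us ws (toggle P x I) ⟩
    toggleList P ws (toggleList P us (toggle P x I))
      ≡⟨ cong (toggleList P ws) (toggle-toggleList-comm x I us I-ideal us-not-adjacent) ⟨
    toggleList P ws (toggle P x (toggleList P us I))    ≡⟨ toggleList-++ us (x ∷ ws) I ⟨
    toggleList P (us ++ x ∷ ws) I                       ∎
    where
    open ≡-Reasoning
    xs↭us++ws : xs ↭ us ++ ws
    xs↭us++ws = drop-mid [] us xs↭ys
    us-not-adjacent : All (¬_ ∘ Adjacent x) us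
    us-not-adjacent = All.tabulate λ u∈us adj →
      ℤ.<-asym (All.lookup x↓ (∈-resp-↭ (↭-sym xs↭us++ws) (∈-++⁺ˡ u∈us)) adj)
               (All.lookup us↓x u∈us (Adjacent-sym adj))

module Sweeping (P : FinPoset) where
  open Toggling P using (toggleList-++)

  sweepList : List (Elt P) → (Elt P → ℤ) → ℤ → ℕ → List (Elt P)
  sweepList cands key hi zero    = []
  sweepList cands key hi (suc k) = filter (λ x → key x ℤ.≟ hi) cands ++ sweepList cands key (hi - 1ℤ) k

  sweepDown≡toggleList : ∀ cands key hi k I →
                         sweepDown P cands key hi k I ≡ toggleList P (sweepList cands key hi k) I
  sweepDown≡toggleList cands key hi zero I = refl
  sweepDown≡toggleList cands key hi (suc k) I =
    trans (sweepDown≡toggleList cands key (hi - 1ℤ) k _)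
          (sym (toggleList-++ (filter (λ x → key x ℤ.≟ hi) cands) _ I))

  private
    i-1<i : ∀ i → i - 1ℤ ℤ.< i
    i-1<i i = ℤ.i≤pred[j]⇒i<j (ℤ.≤-reflexive (ℤ.+-comm i ℤ.-1ℤ))

    <⇒≤-1 : ∀ {i j} → i ℤ.< j → i ℤ.≤ j - 1ℤ
    <⇒≤-1 {j = j} i<j = ℤ.≤-trans (ℤ.i<j⇒i≤pred[j] i<j) (ℤ.≤-reflexive (ℤ.+-comm ℤ.-1ℤ j))

  module _ (cands : List (Elt P)) (key : Elt P → ℤ) where

    private
      level? : (hi : ℤ) → Decidable (λ x → key x ≡ hi)
      level? hi x = key x ℤ.≟ hi

      level-∈⁻ : ∀ hi {z} → z ∈ filter (level? hi) cands → z ∈ cands × key z ≡ hi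
      level-∈⁻ hi = ∈-filter⁻ (level? hi) {xs = cands}

    sweepList-∈⁻ : ∀ hi k {z} → z ∈ sweepList cands key hi k → z ∈ cands × key z ℤ.≤ hi
    sweepList-∈⁻ hi (suc k) z∈ with ∈-++⁻ (filter (level? hi) cands) z∈
    ... | inj₁ z∈level = proj₁ (level-∈⁻ hi z∈level) , ℤ.≤-reflexive (proj₂ (level-∈⁻ hi z∈level))
    ... | inj₂ z∈rest with z∈cands , z≤hi-1 ← sweepList-∈⁻ (hi - 1ℤ) k z∈rest =
      z∈cands , ℤ.<⇒≤ (ℤ.≤-<-trans z≤hi-1 (i-1<i hi))

    sweepList-∈⁺ : ∀ hi k {z} → z ∈ cands → hi - + k ℤ.< key z → key z ℤ.≤ hi → z ∈ sweepList cands key hi k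
    sweepList-∈⁺ hi zero z∈ lo<z z≤hi =
      ⊥-elim (ℤ.<-irrefl refl (ℤ.<-≤-trans (subst (ℤ._< _) (ℤ.+-identityʳ hi) lo<z) z≤hi))
    sweepList-∈⁺ hi (suc k) {z} z∈ lo<z z≤hi with key z ℤ.≟ hi
    ... | yes z≡hi = ∈-++⁺ˡ (∈-filter⁺ (level? hi) z∈ z≡hi)
    ... | no z≢hi = ∈-++⁺ʳ (filter (level? hi) cands)
          (sweepList-∈⁺ (hi - 1ℤ) k z∈ (subst (ℤ._< key z) (sym (shift hi (+ k))) lo<z)
                        (<⇒≤-1 (ℤ.≤∧≢⇒< z≤hi z≢hi)))
      where
      shift : ∀ h t → (h - 1ℤ) - t ≡ h - (1ℤ + t)
      shift = solve-∀

    sweepList-unique : Unique cands → ∀ hi k → Unique (sweepList cands key hi k)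
    sweepList-unique cands! hi zero = []
    sweepList-unique cands! hi (suc k) =
      Unique.++⁺ (Unique.filter⁺ (level? hi) cands!) (sweepList-unique cands! (hi - 1ℤ) k)
        λ (z∈level , z∈rest) → ℤ.<-irrefl (proj₂ (level-∈⁻ hi z∈level))
                                 (ℤ.≤-<-trans (proj₂ (sweepList-∈⁻ (hi - 1ℤ) k z∈rest)) (i-1<i hi))

    sweepList-sorted : ∀ {R : Rel (Elt P) 0ℓ} →
                       (∀ {x y} → x ∈ cands → y ∈ cands → key y ℤ.≤ key x → R x y) →
                       ∀ hi k → AllPairs R (sweepList cands key hi k)
    sweepList-sorted R-of hi zero = []
    sweepList-sorted R-of hi (suc k) =
      allPairs-++⁺ (allPairs-tabulate λ x∈ y∈ →
                      R-of (cand x∈) (cand y∈) (ℤ.≤-reflexive (trans (level y∈) (sym (level x∈)))))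
                   (sweepList-sorted R-of (hi - 1ℤ) k)
                   λ x∈ y∈ → let y∈cands , y≤hi-1 = sweepList-∈⁻ (hi - 1ℤ) k y∈ in
                     R-of (cand x∈) y∈cands
                          (ℤ.≤-trans (ℤ.<⇒≤ (ℤ.≤-<-trans y≤hi-1 (i-1<i hi))) (ℤ.≤-reflexive (sym (level x∈))))
      where
      cand : ∀ {x} → x ∈ filter (level? hi) cands → x ∈ cands
      cand = proj₁ ∘ level-∈⁻ hi
      level : ∀ {x} → x ∈ filter (level? hi) cands → key x ≡ hi
      level = proj₂ ∘ level-∈⁻ hi

module Layering (P : FinPoset) (rk : Elt P → ℤ) (rk-ranks : IsRankFunction P rk)
                {n : ℕ} (a : Vector ℕ (suc n)) (π : Elt P → Vector ℤ (suc n))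
                (π-projects : IsLatticeProjection P rk π)
                (π-bounded : ∀ x i → (+ 1 ℤ.≤ π x i) × (π x i ℤ.≤ + a i))
                (v : Vector ℤ (suc n)) (v-signs : ∀ i → (v i ≡ + 1) ⊎ (v i ≡ - + 1))
                (γ : Fin (suc n)) where

  open FinPoset P using (size)
  open Toggling P
  open Sweeping P

  B : ℕ
  B = sumℕ a

  ord : Elt P → ℤ
  ord x = ⟪ π x , v ⟫

  ord* : Elt P → ℤ
  ord* x = ⟪ removeAt (π x) γ , removeAt v γ ⟫

  ord-split : ∀ x → ord x ≡ π x γ * v γ + ord* x
  ord-split x = ⟪⟫-removeAt (π x) v γ

  ∣v∣≡1 : ∀ i → ∣ v i ∣ ≡ 1
  ∣v∣≡1 i with v-signs i
  ... | inj₁ vi≡1 = cong ∣_∣ vi≡1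
  ... | inj₂ vi≡-1 = cong ∣_∣ vi≡-1

  ∣π∣≤a : ∀ x i → ∣ π x i ∣ ℕ.≤ a i
  ∣π∣≤a x i = ∣q∣≤a (proj₁ (π-bounded x i)) (proj₂ (π-bounded x i))
    where
    ∣q∣≤a : ∀ {q m} → + 1 ℤ.≤ q → q ℤ.≤ + m → ∣ q ∣ ℕ.≤ m
    ∣q∣≤a (+≤+ _) (+≤+ q≤m) = q≤m

  ∣ord∣≤B : ∀ x → ∣ ord x ∣ ℕ.≤ B
  ∣ord∣≤B x = ∣⟪⟫∣≤ (π x) v a (∣π∣≤a x) ∣v∣≡1

  ∣ord*∣≤B : ∀ x → ∣ ord* x ∣ ℕ.≤ B
  ∣ord*∣≤B x = ℕ.≤-trans
    (∣⟪⟫∣≤ (removeAt (π x) γ) (removeAt v γ) (removeAt a γ) (∣π∣≤a x ∘ punchIn γ) (∣v∣≡1 ∘ punchIn γ))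
    (ℕ.≤-trans (ℕ.m≤n+m _ (a γ)) (ℕ.≤-reflexive (sym (sumℕ-removeAt a γ))))

  cover-step : ∀ {x y} → x ⋖ᴾ y → ∃ λ k → π y k ≡ π x k + 1ℤ × (∀ i → i ≢ k → π y i ≡ π x i)
  cover-step {x} {y} x⋖y = unit-increment (π x) (π y) (proj₁ π-projects x y (proj₁ (proj₁ x⋖y))) (begin
    sumℤ (π y)      ≡⟨ proj₂ π-projects y ⟩
    rk y            ≡⟨ rk-ranks x y x⋖y ⟩
    rk x + 1ℤ       ≡⟨ cong (_+ 1ℤ) (proj₂ π-projects x) ⟨
    sumℤ (π x) + 1ℤ ∎)
    where open ≡-Reasoning

  cover-changes-ord : ∀ {x y} → x ⋖ᴾ y → ord y ≢ ord x
  cover-changes-ord {x} {y} x⋖y ordy≡ordx =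
    let k , yk≡xk+1 , y≗x = cover-step x⋖y in
    +-unit-≢ (ord x) (∣v∣≡1 k) (trans (sym (⟪⟫-increment (π x) (π y) v k yk≡xk+1 y≗x)) ordy≡ordx)

  adjacent-ord≢ : ∀ {x y} → Adjacent x y → ord x ≢ ord y
  adjacent-ord≢ (inj₁ x⋖y) = cover-changes-ord x⋖y ∘ sym
  adjacent-ord≢ (inj₂ y⋖x) = cover-changes-ord y⋖x

  cover-ord*≡ : ∀ {x y} → x ⋖ᴾ y → π x γ ≢ π y γ → ord* x ≡ ord* y
  cover-ord*≡ {x} {y} x⋖y πxγ≢πyγ =
    let k , _ , y≗x = cover-step x⋖y in
    ⟪removeAt⟫-cong v γ λ i i≢γ → sym (changed-coordinate-unique k γ y≗x πxγ≢πyγ i i≢γ)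

  adjacent-ord*≡ : ∀ {x y} → Adjacent x y → π x γ ≢ π y γ → ord* x ≡ ord* y
  adjacent-ord*≡ (inj₁ x⋖y) = cover-ord*≡ x⋖y
  adjacent-ord*≡ (inj₂ y⋖x) πxγ≢πyγ = sym (cover-ord*≡ y⋖x (πxγ≢πyγ ∘ sym))

  Descends-across-layers : ∀ {x y} → π y γ * v γ ℤ.< π x γ * v γ → Descends ord x y
  Descends-across-layers {x} {y} y<x adj = begin-strict
    ord y                    ≡⟨ ord-split y ⟩
    π y γ * v γ + ord* y     <⟨ ℤ.+-monoˡ-< (ord* y) y<x ⟩
    π x γ * v γ + ord* y     ≡⟨ cong (_+_ (π x γ * v γ)) (adjacent-ord*≡ adj πxγ≢πyγ) ⟨
    π x γ * v γ + ord* x     ≡⟨ ord-split x ⟨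
    ord x                    ∎
    where
    open ℤ.≤-Reasoning
    πxγ≢πyγ : π x γ ≢ π y γ
    πxγ≢πyγ e = ℤ.<-irrefl (cong (_* v γ) (sym e)) y<x

  Descends-within-layer : ∀ {x y} → π x γ ≡ π y γ → ord* y ℤ.≤ ord* x → Descends ord x y
  Descends-within-layer {x} {y} πxγ≡πyγ y≤x adj = ℤ.≤∧≢⇒< (begin
    ord y                    ≡⟨ ord-split y ⟩
    π y γ * v γ + ord* y     ≤⟨ ℤ.+-mono-≤ (ℤ.≤-reflexive (cong (_* v γ) (sym πxγ≡πyγ))) y≤x ⟩
    π x γ * v γ + ord* x     ≡⟨ ord-split x ⟨
    ord x                    ∎) (adjacent-ord≢ adj ∘ sym)
    where open ℤ.≤-Reasoning

  levels : ℕ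
  levels = suc (B ℕ.+ B)

  sweep-complete : ∀ cands key {z} → z ∈ cands → ∣ key z ∣ ℕ.≤ B → z ∈ sweepList cands key (+ B) levels
  sweep-complete cands key {z} z∈ ∣key∣≤B =
    let lo<z , z≤hi = sweep-window B (key z) ∣key∣≤B in sweepList-∈⁺ cands key (+ B) levels z∈ lo<z z≤hi

  proList : List (Elt P)
  proList = sweepList (allFin size) ord (+ B) levels

  Pro≡toggleList : ∀ {L} → Unique L → (∀ z → z ∈ L) → AllPairs (Descends ord) L →
                   ∀ I → IsOrderIdeal P I → Pro P a π v I ≡ toggleList P L I
  Pro≡toggleList L! L-complete L↓ I I-ideal =
    trans (sweepDown≡toggleList (allFin size) ord (+ B) levels I)
          (toggleList-↭ ord (↭-of-enumerations proList! L! proList-complete L-complete) proList↓ L↓ I I-ideal)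
    where
    proList! : Unique proList
    proList! = sweepList-unique (allFin size) ord (Unique.allFin⁺ size) (+ B) levels
    proList-complete : ∀ z → z ∈ proList
    proList-complete z = sweep-complete (allFin size) ord (∈-allFin z) (∣ord∣≤B z)
    proList↓ : AllPairs (Descends ord) proList
    proList↓ = sweepList-sorted (allFin size) ord (λ _ _ y≤x adj → ℤ.≤∧≢⇒< y≤x (adjacent-ord≢ adj ∘ sym)) (+ B) levels

  private
    in-layer? : (j : ℕ) → Decidable (λ x → π x γ ≡ + j)
    in-layer? j x = π x γ ℤ.≟ + j

    layerCands : ℕ → List (Elt P)
    layerCands j = filter (in-layer? j) (allFin size)

    in-layer⁻ : ∀ j {z} → z ∈ layerCands j → π z γ ≡ + j
    in-layer⁻ j = proj₂ ∘ ∈-filter⁻ (in-layer? j) {xs = allFin size}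

  layer : ℕ → List (Elt P)
  layer j = sweepList (layerCands j) ord* (+ B) levels

  layer-∈⁻ : ∀ j {z} → z ∈ layer j → π z γ ≡ + j
  layer-∈⁻ j z∈ = in-layer⁻ j (proj₁ (sweepList-∈⁻ (layerCands j) ord* (+ B) levels z∈))

  layer-∈⁺ : ∀ j {z} → π z γ ≡ + j → z ∈ layer j
  layer-∈⁺ j {z} πzγ≡j = sweep-complete (layerCands j) ord* (∈-filter⁺ (in-layer? j) (∈-allFin z) πzγ≡j) (∣ord*∣≤B z)

  layer-unique : ∀ j → Unique (layer j)
  layer-unique j = sweepList-unique (layerCands j) ord* (Unique.filter⁺ (in-layer? j) (Unique.allFin⁺ size)) (+ B) levels

  layer-sorted : ∀ j → AllPairs (Descends ord) (layer j)
  layer-sorted j = sweepList-sorted (layerCands j) ord*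
    (λ x∈ y∈ → Descends-within-layer (trans (in-layer⁻ j x∈) (sym (in-layer⁻ j y∈)))) (+ B) levels

  private
    ≢+suc : ∀ {q} k → q ≡ + suc k → q ℤ.≤ + k → ⊥
    ≢+suc k refl q≤k = ℕ.<-irrefl refl (ℤ.drop‿+≤+ q≤k)

    ≤+k : ∀ {q} k → q ℤ.≤ + suc k → q ≢ + suc k → q ℤ.≤ + k
    ≤+k k q≤ q≢ = ℤ.i<j⇒i≤pred[j] (ℤ.≤∧≢⇒< q≤ q≢)

    <+suc : ∀ {q} k → q ℤ.≤ + k → q ℤ.< + suc k
    <+suc k q≤k = ℤ.≤-<-trans q≤k (ℤ.+<+ (ℕ.n<1+n k))

  descendingLayers : ℕ → List (Elt P)
  descendingLayers zero    = []
  descendingLayers (suc k) = layer (suc k) ++ descendingLayers k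

  ascendingLayers : ℕ → List (Elt P)
  ascendingLayers zero    = []
  ascendingLayers (suc k) = ascendingLayers k ++ layer (suc k)

  layersDown≡toggleList : ∀ k I → layersDown P a π v γ k I ≡ toggleList P (descendingLayers k) I
  layersDown≡toggleList zero I = refl
  layersDown≡toggleList (suc k) I = begin
    layersDown P a π v γ k (layerT P a π v γ (suc k) I)
      ≡⟨ layersDown≡toggleList k _ ⟩
    toggleList P (descendingLayers k) (layerT P a π v γ (suc k) I)
      ≡⟨ cong (toggleList P (descendingLayers k)) (sweepDown≡toggleList (layerCands (suc k)) ord* (+ B) levels I) ⟩
    toggleList P (descendingLayers k) (toggleList P (layer (suc k)) I)
      ≡⟨ toggleList-++ (layer (suc k)) (descendingLayers k) I ⟨
    toggleList P (descendingLayers (suc k)) I ∎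
    where open ≡-Reasoning

  layersUp≡toggleList : ∀ k I → layersUp P a π v γ k I ≡ toggleList P (ascendingLayers k) I
  layersUp≡toggleList zero I = refl
  layersUp≡toggleList (suc k) I = begin
    layerT P a π v γ (suc k) (layersUp P a π v γ k I)
      ≡⟨ sweepDown≡toggleList (layerCands (suc k)) ord* (+ B) levels (layersUp P a π v γ k I) ⟩
    toggleList P (layer (suc k)) (layersUp P a π v γ k I)
      ≡⟨ cong (toggleList P (layer (suc k))) (layersUp≡toggleList k I) ⟩
    toggleList P (layer (suc k)) (toggleList P (ascendingLayers k) I)
      ≡⟨ toggleList-++ (ascendingLayers k) (layer (suc k)) I ⟨
    toggleList P (ascendingLayers (suc k)) I ∎
    where open ≡-Reasoning

  descendingLayers-∈⁻ : ∀ k {z} → z ∈ descendingLayers k → π z γ ℤ.≤ + k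
  descendingLayers-∈⁻ (suc k) z∈ with ∈-++⁻ (layer (suc k)) z∈
  ... | inj₁ z∈layer = ℤ.≤-reflexive (layer-∈⁻ (suc k) z∈layer)
  ... | inj₂ z∈rest  = ℤ.<⇒≤ (<+suc k (descendingLayers-∈⁻ k z∈rest))

  ascendingLayers-∈⁻ : ∀ k {z} → z ∈ ascendingLayers k → π z γ ℤ.≤ + k
  ascendingLayers-∈⁻ (suc k) z∈ with ∈-++⁻ (ascendingLayers k) z∈
  ... | inj₁ z∈rest  = ℤ.<⇒≤ (<+suc k (ascendingLayers-∈⁻ k z∈rest))
  ... | inj₂ z∈layer = ℤ.≤-reflexive (layer-∈⁻ (suc k) z∈layer)

  descendingLayers-∈⁺ : ∀ k {z} → + 1 ℤ.≤ π z γ → π z γ ℤ.≤ + k → z ∈ descendingLayers k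
  descendingLayers-∈⁺ zero 1≤ ≤0 with () ← ℤ.drop‿+≤+ (ℤ.≤-trans 1≤ ≤0)
  descendingLayers-∈⁺ (suc k) {z} 1≤ ≤k+1 with π z γ ℤ.≟ + suc k
  ... | yes ≡k+1 = ∈-++⁺ˡ (layer-∈⁺ (suc k) ≡k+1)
  ... | no ≢k+1  = ∈-++⁺ʳ (layer (suc k)) (descendingLayers-∈⁺ k 1≤ (≤+k k ≤k+1 ≢k+1))

  ascendingLayers-∈⁺ : ∀ k {z} → + 1 ℤ.≤ π z γ → π z γ ℤ.≤ + k → z ∈ ascendingLayers k
  ascendingLayers-∈⁺ zero 1≤ ≤0 with () ← ℤ.drop‿+≤+ (ℤ.≤-trans 1≤ ≤0)
  ascendingLayers-∈⁺ (suc k) {z} 1≤ ≤k+1 with π z γ ℤ.≟ + suc k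
  ... | yes ≡k+1 = ∈-++⁺ʳ (ascendingLayers k) (layer-∈⁺ (suc k) ≡k+1)
  ... | no ≢k+1  = ∈-++⁺ˡ (ascendingLayers-∈⁺ k 1≤ (≤+k k ≤k+1 ≢k+1))

  descendingLayers-unique : ∀ k → Unique (descendingLayers k)
  descendingLayers-unique zero    = []
  descendingLayers-unique (suc k) =
    Unique.++⁺ (layer-unique (suc k)) (descendingLayers-unique k)
      λ (z∈layer , z∈rest) → ≢+suc k (layer-∈⁻ (suc k) z∈layer) (descendingLayers-∈⁻ k z∈rest)

  ascendingLayers-unique : ∀ k → Unique (ascendingLayers k)
  ascendingLayers-unique zero    = []
  ascendingLayers-unique (suc k) =
    Unique.++⁺ (ascendingLayers-unique k) (layer-unique (suc k))
      λ (z∈rest , z∈layer) → ≢+suc k (layer-∈⁻ (suc k) z∈layer) (ascendingLayers-∈⁻ k z∈rest)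

  descendingLayers-sorted : v γ ≡ + 1 → ∀ k → AllPairs (Descends ord) (descendingLayers k)
  descendingLayers-sorted vγ≡1 zero    = []
  descendingLayers-sorted vγ≡1 (suc k) =
    allPairs-++⁺ (layer-sorted (suc k)) (descendingLayers-sorted vγ≡1 k) λ {x} {y} x∈ y∈ →
      Descends-across-layers (subst₂ ℤ._<_ (scale (π y γ)) (scale (π x γ))
        (subst (π y γ ℤ.<_) (sym (layer-∈⁻ (suc k) x∈)) (<+suc k (descendingLayers-∈⁻ k y∈))))
    where
    scale : ∀ q → q ≡ q * v γ
    scale q = sym (trans (cong (q *_) vγ≡1) (ℤ.*-identityʳ q))

  ascendingLayers-sorted : v γ ≡ - + 1 → ∀ k → AllPairs (Descends ord) (ascendingLayers k)
  ascendingLayers-sorted vγ≡-1 zero    = []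
  ascendingLayers-sorted vγ≡-1 (suc k) =
    allPairs-++⁺ (ascendingLayers-sorted vγ≡-1 k) (layer-sorted (suc k)) λ {x} {y} x∈ y∈ →
      Descends-across-layers (subst₂ ℤ._<_ (scale (π y γ)) (scale (π x γ)) (ℤ.neg-mono-<
        (subst (π x γ ℤ.<_) (sym (layer-∈⁻ (suc k) y∈)) (<+suc k (ascendingLayers-∈⁻ k x∈)))))
    where
    scale : ∀ q → - q ≡ q * v γ
    scale q = sym (trans (cong (q *_) vγ≡-1) (trans (ℤ.*-comm q ℤ.-1ℤ) (ℤ.-1*i≡-i q)))

  Pro≡layersDown : v γ ≡ + 1 → ∀ I → IsOrderIdeal P I → Pro P a π v I ≡ layersDown P a π v γ (a γ) I
  Pro≡layersDown vγ≡1 I I-ideal = trans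
    (Pro≡toggleList (descendingLayers-unique (a γ))
                    (λ z → descendingLayers-∈⁺ (a γ) (proj₁ (π-bounded z γ)) (proj₂ (π-bounded z γ)))
                    (descendingLayers-sorted vγ≡1 (a γ)) I I-ideal)
    (sym (layersDown≡toggleList (a γ) I))

  Pro≡layersUp : v γ ≡ - + 1 → ∀ I → IsOrderIdeal P I → Pro P a π v I ≡ layersUp P a π v γ (a γ) I
  Pro≡layersUp vγ≡-1 I I-ideal = trans
    (Pro≡toggleList (ascendingLayers-unique (a γ))
                    (λ z → ascendingLayers-∈⁺ (a γ) (proj₁ (π-bounded z γ)) (proj₂ (π-bounded z γ)))
                    (ascendingLayers-sorted vγ≡-1 (a γ)) I I-ideal)
    (sym (layersUp≡toggleList (a γ) I))

theorem6p6 : (P : FinPoset) (rk : Elt P → ℤ) → IsRankFunction P rk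
  → (n : ℕ) (a : Vector ℕ (suc n)) (π : Elt P → Vector ℤ (suc n))
  → IsLatticeProjection P rk π
  → (∀ x i → (+ 1 ≤ π x i) × (π x i ≤ + a i))
  → (v : Vector ℤ (suc n)) → (∀ i → (v i ≡ + 1) ⊎ (v i ≡ - + 1))
  → (γ : Fin (suc n))
  → (v γ ≡ + 1 → ∀ I → IsOrderIdeal P I
       → Pro P a π v I ≡ layersDown P a π v γ (a γ) I)
    × (v γ ≡ - + 1 → ∀ I → IsOrderIdeal P I
       → Pro P a π v I ≡ layersUp P a π v γ (a γ) I)
theorem6p6 P rk rk-ranks n a π π-projects π-bounded v v-signs γ = Pro≡layersDown , Pro≡layersUp
  where open Layering P rk rk-ranks a π π-projects π-bounded v v-signs γ
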